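{- Let $N=(S,T,F)$ be a Petri net, $m,m'$ markings, and $\Omega$ a total order on $\mathbb{N}^T$ as described in the context. Let $\sigma\in T^*$ be a firing sequence from $m$ to $m'$ and let $x=\wp(\sigma)$ (so $x$ is a solution of the state equation $m+Cx=m'$). Let $\Gamma$ be the family consisting of the (increment) constraints $t\ge x(t)$ for every $t\in T$ with $x(t)>0$. Then $(\Gamma,x,\sigma,0)$ is a full solution of the reachability problem $(N,m,m')$.
   Context: A Petri net is $N=(S,T,F)$ with finite disjoint nonempty sets $S$ (places), $T$ (transitions) and $F\colon (S\times T)\cup(T\times S)\to\mathbb{N}$. A marking is $m\colon S\to\mathbb{N}$; $t$ is enabled under $m$ if $m(s)\ge F(s,t)$ for all $s$, and firing it yields $m'(s)=m(s)-F(s,t)+F(t,s)$. Firing sequences $\sigma\in T^*$ from $m$ (to $m'$) are defined inductively as usual (empty word from $m$ to $m$; $wt$ if $w$ leads from $m$ to $m''$ and $t$ fires under $m''$); $m\xrightarrow{\sigma}$ means $\sigma$ is a firing sequence under $m$. The Parikh image $\wp(\sigma)\in\mathbb{N}^T$ counts occurrences of each transition in $\sigma$. The incidence matrix is $C_{s,t}=F(t,s)-F(s,t)$ and the state equation is $m+Cx=m'$, $x\in\mathbb{N}^T$. A jump constraint is an inequality $t<n$ with $t\in T$, $n\in\mathbb{N}$; an increment constraint is an inequality $\sum_{i=1}^k n_i t_i\ge n$ with $n_i\in\mathbb{Z}$, $n\in\mathbb{N}$, $t_i\in T$; a vector $x\in\mathbb{N}^T$ satisfies a constraint if the inequality holds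 after substituting $x(t)$ for each $t$. Fix a total order $\Omega$ on $\mathbb{N}^T$ such that $\sum_t x(t)<\sum_t y(t)$ implies $x<_\Omega y$. A partial solution of $(N,m,m')$ is a tuple $(\Gamma,x,\sigma,r)$ where $\Gamma$ is a finite family of jump and increment constraints, $x$ is the $\Omega$-smallest vector in $\mathbb{N}^T$ satisfying the state equation and all constraints of $\Gamma$, $\sigma\in T^*$ is a firing sequence under $m$ with $\wp(\sigma)\le x$ componentwise, $r=x-\wp(\sigma)$, and for every $t\in T$ with $r(t)>0$, $\sigma t$ is not a firing sequence under $m$. A full solution is a partial solution with $r=0$. -}

module Defs where

open import Level using (0ℓ)
open import Data.Nat as ℕ using (ℕ; zero; suc; _≤_; _<_; _∸_; _<?_)
open import Data.Integer as ℤ using (ℤ; +_; _-_)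
open import Data.Fin using (Fin; zero; suc; _≟_)
open import Data.List using (List; []; _∷_; _∷ʳ_; filter; map; allFin)
open import Data.List.Membership.Propositional using (_∈_)
open import Data.Product using (_×_; _,_; ∃)
open import Relation.Nullary using (¬_; yes; no)
open import Relation.Binary using (Rel; IsTotalOrder)
open import Relation.Binary.PropositionalEquality using (_≡_; _≗_)

-- Petri nets N = (S, T, F) with S = Fin nS, T = Fin nT (finite, disjoint,
-- nonempty). F is split into F(s,t) (pre) and F(t,s) (post).

record PetriNet : Set where
  field
    nS     : ℕ
    nT     : ℕ
    S-nonempty : 0 < nS
    T-nonempty : 0 < nT
    Fst    : Fin nS → Fin nT → ℕ
    Fts    : Fin nT → Fin nS → ℕ

module _ (N : PetriNet) where
  open PetriNet N

  Place = Fin nS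
  Trans = Fin nT

  Marking : Set
  Marking = Place → ℕ

  VecT : Set
  VecT = Trans → ℕ

  Enabled : Marking → Trans → Set
  Enabled m t = ∀ s → Fst s t ≤ m s

  Fires : Marking → Trans → Marking → Set
  Fires m t m' = Enabled m t × (∀ s → m' s ≡ (m s ∸ Fst s t) ℕ.+ Fts t s)

  data FiringSeq : Marking → List Trans → Marking → Set where
    fs-nil  : ∀ {m} → FiringSeq m [] m
    fs-snoc : ∀ {m m'' m'} {w t} → FiringSeq m w m'' → Fires m'' t m' →
              FiringSeq m (w ∷ʳ t) m'

  FiringSeqFrom : Marking → List Trans → Set
  FiringSeqFrom m σ = ∃ λ m' → FiringSeq m σ m'

  parikh : List Trans → VecT
  parikh [] t = 0
  parikh (u ∷ σ) t with u ≟ t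
  ... | yes _ = suc (parikh σ t)
  ... | no  _ = parikh σ t

  C : Place → Trans → ℤ
  C s t = + Fts t s - + Fst s t

  sumFinℤ : ∀ {k} → (Fin k → ℤ) → ℤ
  sumFinℤ {zero}  f = + 0
  sumFinℤ {suc k} f = f zero ℤ.+ sumFinℤ (λ i → f (suc i))

  sumFinℕ : ∀ {k} → (Fin k → ℕ) → ℕ
  sumFinℕ {zero}  f = 0
  sumFinℕ {suc k} f = f zero ℕ.+ sumFinℕ (λ i → f (suc i))

  StateEq : Marking → Marking → VecT → Set
  StateEq m m' x = ∀ s → + m s ℤ.+ sumFinℤ (λ t → C s t ℤ.* + x t) ≡ + m' s

  data Constraint : Set where
    jump : Trans → ℕ → Constraint
    incr : List (ℤ × Trans) → ℕ → Constraint

  linSum : List (ℤ × Trans) → VecT → ℤ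
  linSum [] x = + 0
  linSum ((c , t) ∷ cs) x = c ℤ.* + x t ℤ.+ linSum cs x

  Sat : VecT → Constraint → Set
  Sat x (jump t n) = x t < n
  Sat x (incr cs n) = + n ℤ.≤ linSum cs x

  SatAll : VecT → List Constraint → Set
  SatAll x Γ = ∀ c → c ∈ Γ → Sat x c

  record OrderΩ : Set₁ where
    field
      _≤Ω_      : Rel VecT 0ℓ
      isTotal   : IsTotalOrder _≗_ _≤Ω_
      size-compat : ∀ x y → sumFinℕ x < sumFinℕ y → ¬ (y ≤Ω x)

  module _ (Ω : OrderΩ) (m m' : Marking) where
    open OrderΩ Ω

    IsΩMinSol : List Constraint → VecT → Set
    IsΩMinSol Γ x = (StateEq m m' x × SatAll x Γ) ×
                    (∀ y → StateEq m m' y → SatAll y Γ → x ≤Ω y)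

    record IsPartialSolution (Γ : List Constraint) (x : VecT)
                             (σ : List Trans) (r : VecT) : Set where
      field
        minimal   : IsΩMinSol Γ x
        firing    : FiringSeqFrom m σ
        parikh≤x  : ∀ t → parikh σ t ≤ x t
        r-def     : ∀ t → r t ≡ x t ∸ parikh σ t
        stuck     : ∀ t → 0 < r t → ¬ FiringSeqFrom m (σ ∷ʳ t)

    IsFullSolution : List Constraint → VecT → List Trans → VecT → Set
    IsFullSolution Γ x σ r = IsPartialSolution Γ x σ r × (∀ t → r t ≡ 0)

  supportConstraints : VecT → List Constraint
  supportConstraints x =
    map (λ t → incr ((+ 1 , t) ∷ []) (x t)) (filter (λ t → 0 <? x t) (allFin nT))

-- The four ingredients of a full solution (Γ, x, σ, 0) are:
--   * x solves the state equation: each firing of t changes every place s by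
--     C(s,t), and ℘(σt) = ℘(σ) + δₜ, so m + C·℘(σ) = m' by induction on σ;
--     the induction step uses linearity of finite sums and the sifting
--     property  Σᵤ f(u)·δₜ(u) = f(t).
--   * y satisfies Γ exactly when x ≤ y pointwise (on the support of x the
--     constraint says so, off the support x vanishes); hence x satisfies Γ.
--   * x is Ω-minimal: any y that satisfies Γ dominates x pointwise, so either
--     Σ x < Σ y, whence x <_Ω y by the size-compatibility of Ω, or y = x.
--   * σ is fired completely, so r = x - ℘(σ) = 0 and "stuck" is vacuous.
module Submission where

open import Defs
open import Data.Nat as ℕ using (ℕ; zero; suc; _≤_; _<_; _<?_; z≤n)
import Data.Nat.Properties as ℕP
open import Data.Integer as ℤ using (ℤ; +_; _-_)
import Data.Integer.Properties as ℤP
open import Data.Integer.Tactic.RingSolver using (solve-∀)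
open import Data.Fin using (Fin; zero; suc; _≟_)
open import Data.List using (List; []; _∷_; _∷ʳ_)
open import Data.List.Membership.Propositional.Properties
  using (∈-map⁺; ∈-map⁻; ∈-filter⁺; ∈-allFin)
open import Data.Product using (_,_)
open import Data.Sum using (_⊎_; inj₁; inj₂)
open import Data.Empty using (⊥-elim)
open import Relation.Nullary using (¬_; yes; no)
open import Relation.Binary using (IsTotalOrder)
open import Relation.Binary.PropositionalEquality
  using (_≡_; refl; sym; trans; cong; cong₂; _≗_; module ≡-Reasoning)

open ≡-Reasoning

δ : ∀ {k} → Fin k → Fin k → ℕ
δ zero    zero    = 1
δ zero    (suc _) = 0
δ (suc _) zero    = 0
δ (suc t) (suc u) = δ t u

δ-diag : ∀ {k} (t : Fin k) → δ t t ≡ 1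
δ-diag zero    = refl
δ-diag (suc t) = δ-diag t

δ-off : ∀ {k} (t u : Fin k) → ¬ t ≡ u → δ t u ≡ 0
δ-off zero    zero    t≢u = ⊥-elim (t≢u refl)
δ-off zero    (suc u) t≢u = refl
δ-off (suc t) zero    t≢u = refl
δ-off (suc t) (suc u) t≢u = δ-off t u (λ t≡u → t≢u (cong suc t≡u))

module _ (N : PetriNet) where
  open PetriNet N
  open OrderΩ

  -- Basic algebra of the finite sums Σ_{i<k} used by the state equation.
  -- (They are parametrised by N only because Defs defines them inside the net.)

  sumℤ-cong : ∀ {k} {f g : Fin k → ℤ} → f ≗ g → sumFinℤ N f ≡ sumFinℤ N g
  sumℤ-cong {zero}  f≗g = refl
  sumℤ-cong {suc k} f≗g = cong₂ ℤ._+_ (f≗g zero) (sumℤ-cong (λ i → f≗g (suc i)))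

  sumℤ-zero : ∀ k → sumFinℤ N {k} (λ _ → + 0) ≡ + 0
  sumℤ-zero zero    = refl
  sumℤ-zero (suc k) = trans (ℤP.+-identityˡ _) (sumℤ-zero k)

  sumℤ-+ : ∀ {k} (f g : Fin k → ℤ) →
           sumFinℤ N (λ i → f i ℤ.+ g i) ≡ sumFinℤ N f ℤ.+ sumFinℤ N g
  sumℤ-+ {zero}  f g = refl
  sumℤ-+ {suc k} f g = begin
    (f zero ℤ.+ g zero) ℤ.+ sumFinℤ N (λ i → f (suc i) ℤ.+ g (suc i))
      ≡⟨ cong (λ z → (f zero ℤ.+ g zero) ℤ.+ z) (sumℤ-+ (λ i → f (suc i)) (λ i → g (suc i))) ⟩
    (f zero ℤ.+ g zero) ℤ.+ (sumFinℤ N (λ i → f (suc i)) ℤ.+ sumFinℤ N (λ i → g (suc i)))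
      ≡⟨ interchange (f zero) (g zero) _ _ ⟩
    (f zero ℤ.+ sumFinℤ N (λ i → f (suc i))) ℤ.+ (g zero ℤ.+ sumFinℤ N (λ i → g (suc i))) ∎
    where
    interchange : ∀ a b c d → (a ℤ.+ b) ℤ.+ (c ℤ.+ d) ≡ (a ℤ.+ c) ℤ.+ (b ℤ.+ d)
    interchange = solve-∀

  sumℤ-δ : ∀ {k} (f : Fin k → ℤ) (t : Fin k) → sumFinℤ N (λ u → f u ℤ.* + δ t u) ≡ f t
  sumℤ-δ {suc k} f zero = begin
    f zero ℤ.* + 1 ℤ.+ sumFinℤ N (λ i → f (suc i) ℤ.* + 0)
      ≡⟨ cong₂ ℤ._+_ (ℤP.*-identityʳ (f zero)) (sumℤ-cong (λ i → ℤP.*-zeroʳ (f (suc i)))) ⟩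
    f zero ℤ.+ sumFinℤ N {k} (λ _ → + 0)
      ≡⟨ cong (λ z → f zero ℤ.+ z) (sumℤ-zero k) ⟩
    f zero ℤ.+ + 0
      ≡⟨ ℤP.+-identityʳ (f zero) ⟩
    f zero ∎
  sumℤ-δ {suc k} f (suc t) = begin
    f zero ℤ.* + 0 ℤ.+ sumFinℤ N (λ u → f (suc u) ℤ.* + δ t u)
      ≡⟨ cong (ℤ._+ sumFinℤ N (λ u → f (suc u) ℤ.* + δ t u)) (ℤP.*-zeroʳ (f zero)) ⟩
    + 0 ℤ.+ sumFinℤ N (λ u → f (suc u) ℤ.* + δ t u)
      ≡⟨ ℤP.+-identityˡ _ ⟩
    sumFinℤ N (λ u → f (suc u) ℤ.* + δ t u)
      ≡⟨ sumℤ-δ (λ i → f (suc i)) t ⟩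
    f (suc t) ∎

  parikh-snoc : (w : List (Trans N)) (t u : Trans N) → parikh N (w ∷ʳ t) u ≡ parikh N w u ℕ.+ δ t u
  parikh-snoc []      t u with t ≟ u
  ... | yes refl = sym (δ-diag t)
  ... | no  t≢u  = sym (δ-off t u t≢u)
  parikh-snoc (v ∷ w) t u with v ≟ u
  ... | yes _ = cong suc (parikh-snoc w t u)
  ... | no  _ = parikh-snoc w t u

  fire-effect : ∀ {m m' t} → Fires N m t m' → ∀ s → + m' s ≡ + m s ℤ.+ C N s t
  fire-effect {m} {m'} {t} (enabled , m'≡) s = begin
    + m' s                                    ≡⟨ cong +_ (m'≡ s) ⟩
    + (m s ℕ.∸ Fst s t) ℤ.+ + Fts t s          ≡⟨ cong (ℤ._+ + Fts t s) consume ⟩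
    (+ m s - + Fst s t) ℤ.+ + Fts t s          ≡⟨ regroup (+ m s) (+ Fts t s) (+ Fst s t) ⟩
    + m s ℤ.+ (+ Fts t s - + Fst s t)          ∎
    where
    -- Enabledness makes the truncated subtraction on ℕ agree with ℤ.
    consume : + (m s ℕ.∸ Fst s t) ≡ + m s - + Fst s t
    consume = begin
      + (m s ℕ.∸ Fst s t)  ≡⟨ ℤP.≤-⊖ (enabled s) ⟨
      m s ℤ.⊖ Fst s t      ≡⟨ ℤP.m-n≡m⊖n (m s) (Fst s t) ⟨
      + m s - + Fst s t    ∎
    regroup : ∀ a b c → (a - c) ℤ.+ b ≡ a ℤ.+ (b - c)
    regroup = solve-∀

  stateEq-parikh : ∀ {m m'} {σ} → FiringSeq N m σ m' → StateEq N m m' (parikh N σ)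
  stateEq-parikh {m} fs-nil s = begin
    + m s ℤ.+ sumFinℤ N (λ u → C N s u ℤ.* + 0)
      ≡⟨ cong (λ z → + m s ℤ.+ z) (sumℤ-cong (λ u → ℤP.*-zeroʳ (C N s u))) ⟩
    + m s ℤ.+ sumFinℤ N {nT} (λ _ → + 0)
      ≡⟨ cong (λ z → + m s ℤ.+ z) (sumℤ-zero nT) ⟩
    + m s ℤ.+ + 0
      ≡⟨ ℤP.+-identityʳ (+ m s) ⟩
    + m s ∎
  stateEq-parikh {m} {m'} (fs-snoc {m'' = m''} {w = w} {t = t} fs fire) s = begin
    + m s ℤ.+ sumFinℤ N (λ u → C N s u ℤ.* + parikh N (w ∷ʳ t) u)
      ≡⟨ cong (λ z → + m s ℤ.+ z) (sumℤ-cong split) ⟩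
    + m s ℤ.+ sumFinℤ N (λ u → effect-w u ℤ.+ effect-t u)
      ≡⟨ cong (λ z → + m s ℤ.+ z) (sumℤ-+ effect-w effect-t) ⟩
    + m s ℤ.+ (sumFinℤ N effect-w ℤ.+ sumFinℤ N effect-t)
      ≡⟨ cong (λ z → + m s ℤ.+ (sumFinℤ N effect-w ℤ.+ z)) (sumℤ-δ (C N s) t) ⟩
    + m s ℤ.+ (sumFinℤ N effect-w ℤ.+ C N s t)
      ≡⟨ ℤP.+-assoc (+ m s) (sumFinℤ N effect-w) (C N s t) ⟨
    (+ m s ℤ.+ sumFinℤ N effect-w) ℤ.+ C N s t
      ≡⟨ cong (ℤ._+ C N s t) (stateEq-parikh fs s) ⟩
    + m'' s ℤ.+ C N s t
      ≡⟨ fire-effect fire s ⟨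
    + m' s ∎
    where
    effect-w effect-t : Trans N → ℤ
    effect-w u = C N s u ℤ.* + parikh N w u
    effect-t u = C N s u ℤ.* + δ t u

    split : ∀ u → C N s u ℤ.* + parikh N (w ∷ʳ t) u ≡ effect-w u ℤ.+ effect-t u
    split u = begin
      C N s u ℤ.* + parikh N (w ∷ʳ t) u         ≡⟨ cong (λ n → C N s u ℤ.* + n) (parikh-snoc w t u) ⟩
      C N s u ℤ.* (+ parikh N w u ℤ.+ + δ t u)  ≡⟨ ℤP.*-distribˡ-+ (C N s u) (+ parikh N w u) (+ δ t u) ⟩
      effect-w u ℤ.+ effect-t u                 ∎

  linSum-unit : (x : VecT N) (t : Trans N) → linSum N ((+ 1 , t) ∷ []) x ≡ + x t
  linSum-unit x t = begin
    + 1 ℤ.* + x t ℤ.+ + 0  ≡⟨ ℤP.+-identityʳ _ ⟩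
    + 1 ℤ.* + x t          ≡⟨ ℤP.*-identityˡ _ ⟩
    + x t                  ∎

  dominating⇒sat : (x y : VecT N) → (∀ t → x t ≤ y t) → SatAll N y (supportConstraints N x)
  dominating⇒sat x y x≤y c c∈Γ with ∈-map⁻ (λ t → incr ((+ 1 , t) ∷ []) (x t)) c∈Γ
  ... | t , _ , refl = ℤP.≤-trans (ℤ.+≤+ (x≤y t)) (ℤP.≤-reflexive (sym (linSum-unit y t)))

  sat⇒dominating : (x y : VecT N) → SatAll N y (supportConstraints N x) → ∀ t → x t ≤ y t
  sat⇒dominating x y sat t with 0 <? x t
  ... | yes 0<xt = ℤP.drop‿+≤+ (ℤP.≤-trans constraint (ℤP.≤-reflexive (linSum-unit y t)))
    where
    constraint : + x t ℤ.≤ linSum N ((+ 1 , t) ∷ []) y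
    constraint = sat _ (∈-map⁺ (λ t → incr ((+ 1 , t) ∷ []) (x t))
                                (∈-filter⁺ (λ t → 0 <? x t) (∈-allFin t) 0<xt))
  ... | no 0≮xt rewrite ℕP.n≤0⇒n≡0 (ℕP.≮⇒≥ 0≮xt) = z≤n

  dominating⇒sum<⊎≗ : ∀ {k} (f g : Fin k → ℕ) → (∀ i → f i ≤ g i) →
                      sumFinℕ N f < sumFinℕ N g ⊎ f ≗ g
  dominating⇒sum<⊎≗ {zero}  f g f≤g = inj₂ (λ ())
  dominating⇒sum<⊎≗ {suc k} f g f≤g
    with dominating⇒sum<⊎≗ (λ i → f (suc i)) (λ i → g (suc i)) (λ i → f≤g (suc i))
       | ℕP.m≤n⇒m<n∨m≡n (f≤g zero)
  ... | inj₁ tail< | _          = inj₁ (ℕP.+-mono-≤-< (f≤g zero) tail<)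
  ... | inj₂ tail≗ | inj₁ head< = inj₁ (ℕP.+-mono-<-≤ head< (ℕP.≤-reflexive (sumℕ-cong tail≗)))
    where
    sumℕ-cong : ∀ {k} {f g : Fin k → ℕ} → f ≗ g → sumFinℕ N f ≡ sumFinℕ N g
    sumℕ-cong {zero}  f≗g = refl
    sumℕ-cong {suc k} f≗g = cong₂ ℕ._+_ (f≗g zero) (sumℕ-cong (λ i → f≗g (suc i)))
  ... | inj₂ tail≗ | inj₂ head≡ = inj₂ λ { zero → head≡ ; (suc i) → tail≗ i }

  dominating⇒≤Ω : (Ω : OrderΩ N) (x y : VecT N) → (∀ t → x t ≤ y t) → _≤Ω_ Ω x y
  dominating⇒≤Ω Ω x y x≤y with dominating⇒sum<⊎≗ x y x≤y
  ... | inj₂ x≗y = IsTotalOrder.reflexive (isTotal Ω) x≗y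
  ... | inj₁ Σx<Σy with IsTotalOrder.total (isTotal Ω) x y
  ...   | inj₁ x≤Ωy = x≤Ωy
  ...   | inj₂ y≤Ωx = ⊥-elim (size-compat Ω x y Σx<Σy y≤Ωx)

  support-minimal : (Ω : OrderΩ N) (m m' : Marking N) (x : VecT N) → StateEq N m m' x →
                    IsΩMinSol N Ω m m' (supportConstraints N x) x
  support-minimal Ω m m' x eq =
    (eq , dominating⇒sat x x (λ _ → ℕP.≤-refl)) ,
    λ y _ sat → dominating⇒≤Ω Ω x y (sat⇒dominating x y sat)

corollary3p3 : (N : PetriNet) (Ω : OrderΩ N) (m m' : Marking N)
               (σ : List (Trans N)) → FiringSeq N m σ m' →
               IsFullSolution N Ω m m' (supportConstraints N (parikh N σ))
                 (parikh N σ) σ (λ _ → 0)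
corollary3p3 N Ω m m' σ fs =
  record
    { minimal  = support-minimal N Ω m m' (parikh N σ) (stateEq-parikh N fs)
    ; firing   = m' , fs
    ; parikh≤x = λ _ → ℕP.≤-refl
    ; r-def    = λ t → sym (ℕP.n∸n≡0 (parikh N σ t))
    ; stuck    = λ _ ()
    } , λ _ → refl
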